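{- Let $n\ge1$, $q\in\mathbf Q_{>0}$, and let $X=X_{\Sigma_{n,q}}$. For every torus-invariant irreducible curve $C\subseteq X$ and every $i\in[n]$, the intersection number $(D_{ -\alpha_i}\cdot C)$ is nonnegative. Moreover, for every torus-invariant irreducible curve $C$ there exists $\ell\in[n]$ with $(D_{ -\alpha_\ell}\cdot C)>0$.
   Context: Let $A=A(n,q)$ be the $n\times n$ tridiagonal matrix with $A_{ii}=q+1$, $A_{i,i+1}=-1$, $A_{i+1,i}=-q$, other entries $0$; let $\alpha_1,\dots,\alpha_n$ be its columns and $e_1,\dots,e_n$ the standard basis of $N=\mathbf Z^n$. For disjoint $J,K\subseteq[n]$, $\sigma_{J,K}=\mathrm{cone}(\{e_i\}_{i\in J}\cup\{ -\alpha_k\}_{k\in K})$; $\Sigma_{n,q}$ is the complete simplicial fan of all such cones, and $X_{\Sigma_{n,q}}$ the associated ($\mathbf Q$-factorial, complete) toric variety. $D_{ -\alpha_i}$ denotes the torus-invariant prime divisor corresponding to the ray $\mathrm{cone}(-\alpha_i)$; intersection numbers with curves are the rational ones defined on the $\mathbf Q$-factorial variety. -}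

module Defs where

open import Data.Bool using (Bool; true; false; if_then_else_)
open import Data.Nat as ℕ using (ℕ; zero; suc)
open import Data.Nat.GCD using (gcd)
open import Data.Nat.LCM using (lcm)
open import Data.Integer as ℤ using (ℤ; +_; ∣_∣)
open import Data.Integer.DivMod using (_/ℕ_)
open import Data.Rational as ℚ using (ℚ; 0ℚ; 1ℚ; _/_)
open import Data.Fin using (Fin; zero; suc; toℕ; punchIn)
open import Data.Sum using (_⊎_; inj₁; inj₂)
open import Relation.Nullary using (does)
open import Relation.Binary.PropositionalEquality using (_≡_)
open import Data.Empty using (⊥)
open import Data.Product using (_×_)

Σℤ : {n : ℕ} → (Fin n → ℤ) → ℤ
Σℤ {zero}  f = + 0
Σℤ {suc n} f = f zero ℤ.+ Σℤ (λ i → f (suc i))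

Σℚ : {n : ℕ} → (Fin n → ℚ) → ℚ
Σℚ {zero}  f = 0ℚ
Σℚ {suc n} f = f zero ℚ.+ Σℚ (λ i → f (suc i))

foldℕ : {n : ℕ} → (ℕ → ℕ → ℕ) → ℕ → (Fin n → ℕ) → ℕ
foldℕ {zero}  op e f = e
foldℕ {suc n} op e f = op (f zero) (foldℕ op e (λ i → f (suc i)))

det : {n : ℕ} → (Fin n → Fin n → ℤ) → ℤ
det {zero}  M = + 1
det {suc n} M =
  Σℤ (λ j → sgn (toℕ j) ℤ.* (M zero j ℤ.* det (λ r c → M (suc r) (punchIn j c))))
  where
  sgn : ℕ → ℤ
  sgn zero          = + 1
  sgn (suc zero)    = ℤ.- (+ 1)
  sgn (suc (suc k)) = sgn k

A : (n : ℕ) → ℚ → Fin n → Fin n → ℚ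
A n q i j =
  if does (toℕ i ℕ.≟ toℕ j) then q ℚ.+ 1ℚ
  else if does (suc (toℕ i) ℕ.≟ toℕ j) then ℚ.- 1ℚ
  else if does (toℕ i ℕ.≟ suc (toℕ j)) then ℚ.- q
  else 0ℚ

α : (n : ℕ) → ℚ → Fin n → Fin n → ℚ
α n q k i = A n q i k

primGen : {n : ℕ} → (Fin n → ℚ) → Fin n → ℤ
primGen {n} v = divide g w
  where
  L : ℕ
  L = foldℕ lcm 1 (λ j → ℚ.denominatorℕ (v j))
  w : Fin n → ℤ
  w j = ℚ.numerator (v j) ℤ.* (+ (L ℕ./ ℚ.denominatorℕ (v j)))
  g : ℕ
  g = foldℕ gcd 0 (λ j → ∣ w j ∣)
  divide : ℕ → (Fin n → ℤ) → Fin n → ℤ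
  divide zero    x j = x j
  divide (suc k) x j = x j /ℕ suc k

-- Rays of Σ_{n,q}:  inj₁ i  = cone(e_i),   inj₂ k = cone(-α_k).

Ray : ℕ → Set
Ray n = Fin n ⊎ Fin n

e : {n : ℕ} → Fin n → Fin n → ℤ
e i j = if does (toℕ i ℕ.≟ toℕ j) then + 1 else + 0

gen : (n : ℕ) → ℚ → Ray n → Fin n → ℤ
gen n q (inj₁ i) = e i
gen n q (inj₂ k) = primGen (λ j → ℚ.- α n q k j)

-- Torus-invariant irreducible curves of X_Σ  <->  walls, i.e.
-- (n-1)-dimensional cones τ = σ_{J,K} with J ∩ K = ∅, |J|+|K| = n-1.
-- We encode (J,K) by a labelling of [n]: every index is in J, in K,
-- or is the unique index m outside J ∪ K.

data Label : Set where
  inJ inK out : Label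

record Wall (n : ℕ) : Set where
  field
    lab     : Fin n → Label
    m       : Fin n
    lab-m   : lab m ≡ out
    out-uniq : ∀ j → lab j ≡ out → j ≡ m
open Wall public

-- The two maximal cones containing τ:
--   σ  = σ_{J ∪ {m}, K}  (extra ray e_m),
--   σ' = σ_{J, K ∪ {m}}  (extra ray -α_m).
-- Generator (column j) of σ:
genσ : (n : ℕ) → ℚ → Wall n → Fin n → Fin n → ℤ
genσ n q w j with lab w j
... | inJ = gen n q (inj₁ j)
... | inK = gen n q (inj₂ j)
... | out = gen n q (inj₁ j)

matσ : (n : ℕ) → ℚ → Wall n → Fin n → Fin n → ℤ
matσ n q w r c = genσ n q w c r

multσ : (n : ℕ) → ℚ → Wall n → ℕ
multσ n q w = ∣ det (matσ n q w) ∣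

-- mult(τ) = [N_τ : Σ Z u_ρ] = gcd of the maximal minors of the n×(n-1)
-- matrix of generators of τ (the columns j ≠ m).
multτ : (n : ℕ) → ℚ → Wall n → ℕ
multτ zero    q w = 1
multτ (suc n) q w =
  foldℕ gcd 0 (λ r → ∣ det (λ a b → matσ (suc n) q w (punchIn r a) (punchIn (m w) b)) ∣)

InSigmaUnion : {n : ℕ} → Wall n → Ray n → Set
InSigmaUnion w (inj₁ i) = lab w i ≡ inK → ⊥
InSigmaUnion w (inj₂ k) = lab w k ≡ inJ → ⊥

-- Intersection numbers (D_ρ · V(τ))_ρ on the Q-factorial complete toric
-- variety, characterised as in Cox–Little–Schenck, Lemma 6.4.2 and
-- Prop. 6.4.4:
--   * D_ρ · V(τ) = 0              if ρ ⊄ σ ∪ σ',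
--   * D_{e_m} · V(τ) = mult(τ)/mult(σ),
--   * Σ_ρ (D_ρ · V(τ)) u_ρ = 0   (the wall relation).
-- These conditions determine the numbers uniquely.

toℚ : ℤ → ℚ
toℚ z = z / 1

IsIntersectionNumbers : (n : ℕ) → ℚ → Wall n → (Ray n → ℚ) → Set
IsIntersectionNumbers n q w d =
  ((ρ : Ray n) → (InSigmaUnion w ρ → ⊥) → d ρ ≡ 0ℚ)
  × (d (inj₁ (m w)) ℚ.* toℚ (+ multσ n q w) ≡ toℚ (+ multτ n q w))
  × ((r : Fin n) →
       Σℚ (λ i → d (inj₁ i) ℚ.* toℚ (gen n q (inj₁ i) r))
       ℚ.+ Σℚ (λ k → d (inj₂ k) ℚ.* toℚ (gen n q (inj₂ k) r)) ≡ 0ℚ)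

{-# OPTIONS --safe #-}
module Submission where

-- Write x_k = (D_{-α_k} ⋅ C) t_k, where t_k > 0 takes -α_k to the primitive generator of its
-- ray. With the vanishing conditions, the wall relation Σ_ρ (D_ρ ⋅ C) u_ρ = 0 becomes a linear
-- system S x = b: S is A with the rows and columns indexed by J replaced by those of the
-- identity, and b is mult(τ)/mult(σ) at the index m outside J ∪ K and 0 elsewhere. S is a
-- tridiagonal Z-matrix with 1 + S_{i,i+1} S_{i+1,i} ≤ S_{ii} (for entries of A this reads
-- 1 + q ≤ q + 1), so Gaussian elimination runs with positive pivots: S x = b is solvable, its
-- solution is nonnegative as b is, and row m forces x_m > 0. The same elimination shows that
-- the continuants computing mult(σ) and mult(τ) are positive, so b_m > 0.

open import Defs

-- ℚ's _≤_ is imported only inside this block, as the statement of proposition3p5 uses ℕ's.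
module _ where

  open import Data.Bool using (Bool; true; false; not; _∧_; if_then_else_)
  open import Data.Bool.Properties using (∧-conicalˡ; ∧-conicalʳ)
  open import Data.Empty using (⊥; ⊥-elim)
  open import Data.Fin using (Fin; zero; suc; toℕ; punchIn)
  open import Data.Fin.Properties using (toℕ-injective; suc-injective)
  open import Data.Integer as ℤ using (ℤ; +_; -[1+_])
  import Data.Integer.Properties as ℤP
  import Data.Integer.Solver as ZSolver
  open import Data.Nat as ℕ using (ℕ; zero; suc; s≤s; z≤n)
  open import Data.Nat.Divisibility using (_∣_; ∣-trans; n∣m⇒m%n≡0)
  open import Data.Nat.DivMod using (m/n*n≡m; m*[n/m]≡n)
  open import Data.Nat.GCD using (gcd; gcd[m,n]∣m; gcd[m,n]∣n; gcd[m,n]≡0⇒m≡0; gcd[m,n]≡0⇒n≡0)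
  open import Data.Nat.LCM using (lcm; m∣lcm[m,n]; n∣lcm[m,n]; gcd*lcm)
  import Data.Nat.Coprimality as Coprimality
  import Data.Nat.Properties as ℕP
  open import Data.Product using (∃; ∃-syntax; _×_; _,_; proj₁; proj₂)
  open import Data.Rational as ℚ
    using (ℚ; mkℚ; 0ℚ; 1ℚ; _+_; _*_; _-_; -_; _≤_; _<_; 1/_; _/_)
  import Data.Rational.Properties as ℚP
  open import Data.Rational.Solver using (module +-*-Solver)
  import Data.Rational.Unnormalised as ℚᵘ
  import Data.Rational.Unnormalised.Properties as ℚᵘP
  open import Data.Sum using (_⊎_; inj₁; inj₂; [_,_]′)
  open import Relation.Binary.PropositionalEquality
  open import Relation.Nullary.Decidable using (dec-true; dec-false)
  open import Function using (_∘_)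
  open import Data.Vec.Functional using (_∷_; tail)

  -- Rational arithmetic

  private
    fromℤ : ℤ → ℚ
    fromℤ z = mkℚ z 0 (Coprimality.sym (Coprimality.1-coprimeTo ℤ.∣ z ∣))

    toℚ≡fromℤ : ∀ z → toℚ z ≡ fromℤ z
    toℚ≡fromℤ z = ℚP.↥p/↧p≡p (fromℤ z)

  -- (a/1)(b/1) reduces to (a b)/1, so no normalisation argument is needed.
  toℚ-* : ∀ a b → toℚ (a ℤ.* b) ≡ toℚ a * toℚ b
  toℚ-* a b = sym (cong₂ _*_ (toℚ≡fromℤ a) (toℚ≡fromℤ b))

  toℚ-+ : ∀ a b → toℚ (a ℤ.+ b) ≡ toℚ a + toℚ b
  toℚ-+ a b = begin
    (a ℤ.+ b) / 1                         ≡⟨ ℚP./-cong (sym (cong₂ ℤ._+_ (ℤP.*-identityʳ a) (ℤP.*-identityʳ b))) refl ⟩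
    (a ℤ.* + 1 ℤ.+ b ℤ.* + 1) / (1 ℕ.* 1) ≡⟨ sym (cong₂ _+_ (toℚ≡fromℤ a) (toℚ≡fromℤ b)) ⟩
    toℚ a + toℚ b                         ∎
    where
    open ≡-Reasoning

  toℚ-neg : ∀ a → toℚ (ℤ.- a) ≡ - toℚ a
  toℚ-neg a = trans (toℚ≡fromℤ (ℤ.- a)) (trans (neg-fromℤ a) (cong -_ (sym (toℚ≡fromℤ a))))
    where
    neg-fromℤ : ∀ a → fromℤ (ℤ.- a) ≡ - fromℤ a
    neg-fromℤ (+ zero)  = refl
    neg-fromℤ (+ suc n) = refl
    neg-fromℤ -[1+ n ]  = refl

  toℚ-injective : ∀ {a b} → toℚ a ≡ toℚ b → a ≡ b
  toℚ-injective {a} {b} eq = cong ℚ.numerator (trans (sym (toℚ≡fromℤ a)) (trans eq (toℚ≡fromℤ b)))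

  toℚ-pos : ∀ k → k ≢ 0 → 0ℚ < toℚ (+ k)
  toℚ-pos zero    k≢0 = ⊥-elim (k≢0 refl)
  toℚ-pos (suc k) _   = subst (0ℚ <_) (sym (toℚ≡fromℤ (+ suc k))) (ℚP.positive⁻¹ (fromℤ (+ suc k)))

  toℚ-numerator : ∀ p → toℚ (ℚ.numerator p) ≡ p * toℚ (+ ℚ.denominatorℕ p)
  toℚ-numerator p@(mkℚ n d-1 _) = begin
    toℚ n                     ≡⟨ toℚ≡fromℤ n ⟩
    fromℤ n                   ≡⟨ ℚP.toℚᵘ-injective (ℚᵘP.≃-trans step (ℚᵘP.≃-sym (ℚP.toℚᵘ-homo-* p (fromℤ (+ suc d-1))))) ⟩
    p * fromℤ (+ suc d-1)     ≡⟨ cong (p *_) (sym (toℚ≡fromℤ (+ suc d-1))) ⟩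
    p * toℚ (+ suc d-1)       ∎
    where
    open ≡-Reasoning
    step : ℚᵘ.mkℚᵘ n 0 ℚᵘ.≃ ℚᵘ.mkℚᵘ n d-1 ℚᵘ.* ℚᵘ.mkℚᵘ (+ suc d-1) 0
    step = ℚᵘ.*≡* (trans (cong (λ z → n ℤ.* + suc z) (ℕP.*-identityʳ d-1)) (sym (ℤP.*-identityʳ (n ℤ.* + suc d-1))))

  0<1 : 0ℚ < 1ℚ
  0<1 = ℚP.positive⁻¹ 1ℚ

  *-pos : ∀ {a b} → 0ℚ < a → 0ℚ < b → 0ℚ < a * b
  *-pos {a} {b} 0<a 0<b =
    ℚP.positive⁻¹ (a * b) {{ℚP.pos*pos⇒pos a {{ℚ.positive 0<a}} b {{ℚ.positive 0<b}}}}

  *-nonNeg : ∀ {a b} → 0ℚ ≤ a → 0ℚ ≤ b → 0ℚ ≤ a * b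
  *-nonNeg {a} {b} 0≤a 0≤b =
    ℚP.nonNegative⁻¹ (a * b) {{ℚP.nonNeg*nonNeg⇒nonNeg a {{ℚ.nonNegative 0≤a}} b {{ℚ.nonNegative 0≤b}}}}

  nonPos*nonNeg : ∀ {a b} → a ≤ 0ℚ → 0ℚ ≤ b → a * b ≤ 0ℚ
  nonPos*nonNeg {a} {b} a≤0 0≤b = subst (a * b ≤_) (ℚP.*-zeroˡ b) (ℚP.*-monoʳ-≤-nonNeg b {{ℚ.nonNegative 0≤b}} a≤0)

  *-≢0 : ∀ {a b} → a ≢ 0ℚ → b ≢ 0ℚ → a * b ≢ 0ℚ
  *-≢0 {a} {b} a≢0 b≢0 ab≡0 = b≢0 (begin
    b                 ≡⟨ sym (ℚP.*-identityˡ b) ⟩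
    1ℚ * b            ≡⟨ cong (_* b) (sym (ℚP.*-inverseˡ a)) ⟩
    (1/ a) * a * b    ≡⟨ ℚP.*-assoc (1/ a) a b ⟩
    (1/ a) * (a * b)  ≡⟨ cong ((1/ a) *_) ab≡0 ⟩
    (1/ a) * 0ℚ       ≡⟨ ℚP.*-zeroʳ (1/ a) ⟩
    0ℚ                ∎)
    where
    open ≡-Reasoning
    instance _ = ℚ.≢-nonZero a≢0

  *-≡0 : ∀ {a b} → a ≡ 0ℚ ⊎ b ≡ 0ℚ → a * b ≡ 0ℚ
  *-≡0 {b = b} (inj₁ refl) = ℚP.*-zeroˡ b
  *-≡0 {a = a} (inj₂ refl) = ℚP.*-zeroʳ a

  pos⇒≢0 : ∀ {a} → 0ℚ < a → a ≢ 0ℚ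
  pos⇒≢0 0<a a≡0 = ℚP.<⇒≢ 0<a (sym a≡0)

  positiveInverse : ∀ {a} → 0ℚ < a → ∃[ v ] (a * v ≡ 1ℚ × 0ℚ < v)
  positiveInverse {a} 0<a = 1/ a , ℚP.*-inverseʳ a , ℚP.positive⁻¹ _ {{ℚP.1/pos⇒pos a}}
    where instance
    _ = ℚ.positive 0<a
    _ = ℚP.pos⇒nonZero a

  <-sub : ∀ {a b x} → a + x < b → a < b - x
  <-sub {a} {b} {x} a+x<b = subst (_< b - x) (solve 2 (λ a x → a :+ x :- x := a) refl a x) (ℚP.+-monoˡ-< (- x) a+x<b)
    where
    open +-*-Solver

  <⇒*inverse<1 : ∀ {a v p} → a * v ≡ 1ℚ → 0ℚ < v → p < a → p * v < 1ℚ
  <⇒*inverse<1 {v = v} {p} av≡1 0<v p<a = subst (p * v <_) av≡1 (ℚP.*-monoˡ-<-pos v {{ℚ.positive 0<v}} p<a)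

  sub-nonPos : ∀ {y z} → 0ℚ ≤ y → z ≤ 0ℚ → 0ℚ ≤ y - z
  sub-nonPos {y} {z} 0≤y z≤0 = subst (_≤ y - z) (ℚP.+-identityʳ 0ℚ) (ℚP.+-mono-≤ 0≤y (ℚP.neg-antimono-≤ z≤0))

  Σℚ-cong : ∀ {n} {f g : Fin n → ℚ} → (∀ i → f i ≡ g i) → Σℚ f ≡ Σℚ g
  Σℚ-cong {zero}  f≗g = refl
  Σℚ-cong {suc n} f≗g = cong₂ _+_ (f≗g zero) (Σℚ-cong (f≗g ∘ suc))

  Σℚ-zero : ∀ {n} {f : Fin n → ℚ} → (∀ i → f i ≡ 0ℚ) → Σℚ f ≡ 0ℚ
  Σℚ-zero {zero}  f≗0 = refl
  Σℚ-zero {suc n} f≗0 = trans (cong₂ _+_ (f≗0 zero) (Σℚ-zero (f≗0 ∘ suc))) (ℚP.+-identityʳ 0ℚ)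

  Σℚ-neg : ∀ {n} (f : Fin n → ℚ) → Σℚ (λ i → - f i) ≡ - Σℚ f
  Σℚ-neg {zero}  f = refl
  Σℚ-neg {suc n} f = trans (cong (_+_ (- f zero)) (Σℚ-neg (f ∘ suc))) (sym (ℚP.neg-distrib-+ (f zero) (Σℚ (f ∘ suc))))

  Σℚ-nonPos : ∀ {n} {f : Fin n → ℚ} → (∀ i → f i ≤ 0ℚ) → Σℚ f ≤ 0ℚ
  Σℚ-nonPos {zero}  f≤0 = ℚP.≤-refl
  Σℚ-nonPos {suc n} {f} f≤0 = subst (Σℚ f ≤_) (ℚP.+-identityʳ 0ℚ) (ℚP.+-mono-≤ (f≤0 zero) (Σℚ-nonPos (f≤0 ∘ suc)))

  Σℚ-≤-term : ∀ {n} (f : Fin n → ℚ) r → (∀ c → c ≢ r → f c ≤ 0ℚ) → Σℚ f ≤ f r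
  Σℚ-≤-term f zero    rest≤0 =
    subst (Σℚ f ≤_) (ℚP.+-identityʳ (f zero)) (ℚP.+-monoʳ-≤ (f zero) (Σℚ-nonPos (λ c → rest≤0 (suc c) λ ())))
  Σℚ-≤-term f (suc r) rest≤0 =
    subst (Σℚ f ≤_) (ℚP.+-identityˡ (f (suc r)))
      (ℚP.+-mono-≤ (rest≤0 zero λ ()) (Σℚ-≤-term (f ∘ suc) r (λ c c≢r → rest≤0 (suc c) (c≢r ∘ suc-injective))))

  e-diag : ∀ {n} (i : Fin n) → toℚ (e i i) ≡ 1ℚ
  e-diag zero    = refl
  e-diag (suc i) = e-diag i

  e-off : ∀ {n} {i j : Fin n} → toℕ i ≢ toℕ j → toℚ (e i j) ≡ 0ℚ
  e-off {i = i} {j} i≢j rewrite dec-false (toℕ i ℕ.≟ toℕ j) i≢j = refl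

  Σℚ-e : ∀ {n} (f : Fin n → ℚ) r → Σℚ (λ i → f i * toℚ (e i r)) ≡ f r
  Σℚ-e f zero = begin
    f zero * 1ℚ + Σℚ (λ i → f (suc i) * 0ℚ) ≡⟨ cong₂ _+_ (ℚP.*-identityʳ (f zero)) (Σℚ-zero (ℚP.*-zeroʳ ∘ f ∘ suc)) ⟩
    f zero + 0ℚ                             ≡⟨ ℚP.+-identityʳ (f zero) ⟩
    f zero                                  ∎
    where
    open ≡-Reasoning
  Σℚ-e f (suc r) = begin
    f zero * 0ℚ + Σℚ (λ i → f (suc i) * toℚ (e (suc i) (suc r))) ≡⟨ cong₂ _+_ (ℚP.*-zeroʳ (f zero)) (Σℚ-e (f ∘ suc) r) ⟩
    0ℚ + f (suc r)                                               ≡⟨ ℚP.+-identityˡ (f (suc r)) ⟩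
    f (suc r)                                                    ∎
    where
    open ≡-Reasoning

  -- Tridiagonal matrices, continuants and Gaussian elimination

  Matrix : Set → ℕ → Set
  Matrix A n = Fin n → Fin n → A

  ↓ : ∀ {A n} → Matrix A (suc n) → Matrix A n
  ↓ N r c = N (suc r) (suc c)

  submatrix : ∀ {A n} → Fin (suc n) → Matrix A (suc n) → Matrix A n
  submatrix m N a b = N (punchIn m a) (punchIn m b)

  Far : ℕ → ℕ → Set
  Far i j = 2 ℕ.+ i ℕ.≤ j ⊎ 2 ℕ.+ j ℕ.≤ i

  far⇒≢ : ∀ {i j} → Far i j → i ≢ j
  far⇒≢ (inj₁ 2+i≤j) refl = ℕP.<-irrefl refl (ℕP.<-trans (ℕP.n<1+n _) 2+i≤j)
  far⇒≢ (inj₂ 2+j≤i) refl = ℕP.<-irrefl refl (ℕP.<-trans (ℕP.n<1+n _) 2+j≤i)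

  Tridiagonal : ∀ {A n} → A → Matrix A n → Set
  Tridiagonal 0# N = ∀ r c → Far (toℕ r) (toℕ c) → N r c ≡ 0#

  toℕ-punchIn : ∀ {n} (m : Fin (suc n)) a →
    (toℕ a ℕ.< toℕ m × toℕ (punchIn m a) ≡ toℕ a) ⊎ (toℕ m ℕ.≤ toℕ a × toℕ (punchIn m a) ≡ suc (toℕ a))
  toℕ-punchIn zero    a       = inj₂ (z≤n , refl)
  toℕ-punchIn (suc m) zero    = inj₁ (s≤s z≤n , refl)
  toℕ-punchIn (suc m) (suc a) with toℕ-punchIn m a
  ... | inj₁ (a<m , eq) = inj₁ (s≤s a<m , cong suc eq)
  ... | inj₂ (m≤a , eq) = inj₂ (s≤s m≤a , cong suc eq)

  punchIn-far : ∀ {n} (m : Fin (suc n)) {a b} → 2 ℕ.+ toℕ a ℕ.≤ toℕ b →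
                2 ℕ.+ toℕ (punchIn m a) ℕ.≤ toℕ (punchIn m b)
  punchIn-far m {a} {b} 2+a≤b with toℕ-punchIn m a | toℕ-punchIn m b
  ... | inj₁ (_ , pa) | inj₁ (_ , pb) = subst₂ (λ i j → 2 ℕ.+ i ℕ.≤ j) (sym pa) (sym pb) 2+a≤b
  ... | inj₁ (_ , pa) | inj₂ (_ , pb) = subst₂ (λ i j → 2 ℕ.+ i ℕ.≤ j) (sym pa) (sym pb) (ℕP.m≤n⇒m≤1+n 2+a≤b)
  ... | inj₂ (m≤a , _) | inj₁ (b<m , _) =
    ⊥-elim (ℕP.<-irrefl refl (ℕP.<-≤-trans b<m (ℕP.≤-trans m≤a (ℕP.≤-trans (ℕP.m≤n+m _ 2) 2+a≤b))))
  ... | inj₂ (_ , pa) | inj₂ (_ , pb) = subst₂ (λ i j → 2 ℕ.+ i ℕ.≤ j) (sym pa) (sym pb) (s≤s 2+a≤b)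

  punchIn-adjacent : ∀ {n} (m : Fin (suc n)) {a b} → toℕ b ≡ suc (toℕ a) →
    toℕ (punchIn m b) ≡ suc (toℕ (punchIn m a)) ⊎ toℕ (punchIn m b) ≡ 2 ℕ.+ toℕ (punchIn m a)
  punchIn-adjacent m {a} {b} b≡1+a with toℕ-punchIn m a | toℕ-punchIn m b
  ... | inj₁ (_ , pa) | inj₁ (_ , pb) = inj₁ (trans pb (trans b≡1+a (cong suc (sym pa))))
  ... | inj₁ (_ , pa) | inj₂ (_ , pb) = inj₂ (trans pb (cong suc (trans b≡1+a (cong suc (sym pa)))))
  ... | inj₂ (m≤a , _) | inj₁ (b<m , _) =
    ⊥-elim (ℕP.<-irrefl refl (ℕP.<-≤-trans b<m (ℕP.≤-trans m≤a (ℕP.≤-trans (ℕP.n≤1+n _) (ℕP.≤-reflexive (sym b≡1+a))))))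
  ... | inj₂ (_ , pa) | inj₂ (_ , pb) = inj₁ (trans pb (cong suc (trans b≡1+a (sym pa))))

  module _ {A : Set} {0# : A} where

    tridiagonal-↓ : ∀ {n} {N : Matrix A (suc n)} → Tridiagonal 0# N → Tridiagonal 0# (↓ N)
    tridiagonal-↓ tri r c (inj₁ apart) = tri (suc r) (suc c) (inj₁ (s≤s apart))
    tridiagonal-↓ tri r c (inj₂ apart) = tri (suc r) (suc c) (inj₂ (s≤s apart))

    tridiagonal-submatrix : ∀ {n} {N : Matrix A (suc n)} (m : Fin (suc n)) →
                            Tridiagonal 0# N → Tridiagonal 0# (submatrix m N)
    tridiagonal-submatrix m tri a b (inj₁ apart) = tri (punchIn m a) (punchIn m b) (inj₁ (punchIn-far m apart))
    tridiagonal-submatrix m tri a b (inj₂ apart) = tri (punchIn m a) (punchIn m b) (inj₂ (punchIn-far m apart))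

  coupling : ∀ {k} → Matrix ℚ (suc (suc k)) → ℚ
  coupling N = N zero (suc zero) * N (suc zero) zero

  continuant : ∀ {n} → Matrix ℚ n → ℚ
  continuant {zero}        N = 1ℚ
  continuant {suc zero}    N = N zero zero
  continuant {suc (suc k)} N =
    N zero zero * continuant (↓ N) - coupling N * continuant (↓ (↓ N))

  continuant-cong : ∀ {n} {N N′ : Matrix ℚ n} → (∀ r c → N r c ≡ N′ r c) → continuant N ≡ continuant N′
  continuant-cong {zero}        N≡N′ = refl
  continuant-cong {suc zero}    N≡N′ = N≡N′ zero zero
  continuant-cong {suc (suc k)} N≡N′ =
    cong₂ _-_ (cong₂ _*_ (N≡N′ zero zero) (continuant-cong (λ r c → N≡N′ (suc r) (suc c))))
              (cong₂ _*_ (cong₂ _*_ (N≡N′ zero (suc zero)) (N≡N′ (suc zero) zero))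
                         (continuant-cong (λ r c → N≡N′ (suc (suc r)) (suc (suc c)))))

  Πℚ : ∀ {n} → (Fin n → ℚ) → ℚ
  Πℚ {zero}  s = 1ℚ
  Πℚ {suc n} s = s zero * Πℚ (s ∘ suc)

  Πℚ-≢0 : ∀ {n} (s : Fin n → ℚ) → (∀ i → s i ≢ 0ℚ) → Πℚ s ≢ 0ℚ
  Πℚ-≢0 {zero}  s s≢0 ()
  Πℚ-≢0 {suc n} s s≢0 = *-≢0 (s≢0 zero) (Πℚ-≢0 (s ∘ suc) (s≢0 ∘ suc))

  continuant-scaleColumns : ∀ {n} (N : Matrix ℚ n) (s : Fin n → ℚ) →
                            continuant (λ r c → N r c * s c) ≡ Πℚ s * continuant N
  continuant-scaleColumns {zero}        N s = sym (ℚP.*-identityʳ 1ℚ)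
  continuant-scaleColumns {suc zero}    N s =
    solve 2 (λ a s₀ → a :* s₀ := s₀ :* con 1ℚ :* a) refl (N zero zero) (s zero)
    where
    open +-*-Solver
  continuant-scaleColumns {suc (suc k)} N s =
    trans (cong₂ (λ X Y → a * s₀ * X - b * s₁ * (c * s₀) * Y)
                 (continuant-scaleColumns (↓ N) (s ∘ suc))
                 (continuant-scaleColumns (↓ (↓ N)) (λ i → s (suc (suc i)))))
          (solve 8 (λ a b c s₀ s₁ P X Y →
                      a :* s₀ :* (s₁ :* P :* X) :- b :* s₁ :* (c :* s₀) :* (P :* Y)
                        := s₀ :* (s₁ :* P) :* (a :* X :- b :* c :* Y))
                   refl a b c s₀ s₁ (Πℚ (λ i → s (suc (suc i)))) (continuant (↓ N)) (continuant (↓ (↓ N))))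
    where
    open +-*-Solver
    a b c s₀ s₁ : ℚ
    a = N zero zero
    b = N zero (suc zero)
    c = N (suc zero) zero
    s₀ = s zero
    s₁ = s (suc zero)

  DominatedBy : ℚ → ℚ → Set
  DominatedBy p d = 0ℚ ≤ p × 1ℚ + p ≤ d

  Dominant : ∀ {n} → Matrix ℚ n → Set
  Dominant N = (∀ i → 1ℚ ≤ N i i) × (∀ i j → toℕ j ≡ suc (toℕ i) → DominatedBy (N i j * N j i) (N i i))

  dominant-↓ : ∀ {n} {N : Matrix ℚ (suc n)} → Dominant N → Dominant (↓ N)
  dominant-↓ (diag , off) = diag ∘ suc , λ i j j≡1+i → off (suc i) (suc j) (cong suc j≡1+i)

  dominant-submatrix : ∀ {n} {N : Matrix ℚ (suc n)} (m : Fin (suc n)) →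
                       Tridiagonal 0ℚ N → Dominant N → Dominant (submatrix m N)
  dominant-submatrix {N = N} m tri (diag , off) = diag ∘ punchIn m , off′
    where
    off′ : ∀ a b → toℕ b ≡ suc (toℕ a) → DominatedBy (submatrix m N a b * submatrix m N b a) (submatrix m N a a)
    off′ a b b≡1+a with punchIn-adjacent m b≡1+a
    ... | inj₁ adjacent = off (punchIn m a) (punchIn m b) adjacent
    ... | inj₂ twoApart rewrite tri (punchIn m a) (punchIn m b) (inj₁ (ℕP.≤-reflexive (sym twoApart))) =
      subst (λ p → DominatedBy p (submatrix m N a a)) (sym (ℚP.*-zeroˡ (submatrix m N b a)))
            (ℚP.≤-refl , subst (_≤ submatrix m N a a) (sym (ℚP.+-identityʳ 1ℚ)) (diag (punchIn m a)))

  -- The invariant of Gaussian elimination on a dominant matrix: only the pivot may have lost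
  -- the margin 1 over its coupling.
  WeaklyDominant : ∀ {k} → Matrix ℚ (suc k) → Set
  WeaklyDominant {zero}  N = 0ℚ < N zero zero
  WeaklyDominant {suc k} N = 0ℚ ≤ coupling N × coupling N < N zero zero × Dominant (↓ N)

  dominant⇒weaklyDominant : ∀ {k} {N : Matrix ℚ (suc k)} → Dominant N → WeaklyDominant N
  dominant⇒weaklyDominant {zero}  (diag , _)          = ℚP.<-≤-trans 0<1 (diag zero)
  dominant⇒weaklyDominant {suc k} {N} dom@(_ , off) with off zero (suc zero) refl
  ... | 0≤p , 1+p≤N₀₀ = 0≤p , ℚP.<-≤-trans p<1+p 1+p≤N₀₀ , dominant-↓ {N = N} dom
    where
    p<1+p : coupling N < 1ℚ + coupling N
    p<1+p = subst (_< 1ℚ + coupling N) (ℚP.+-identityˡ (coupling N)) (ℚP.+-monoˡ-< (coupling N) 0<1)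

  pivot-pos : ∀ {k} {N : Matrix ℚ (suc k)} → WeaklyDominant N → 0ℚ < N zero zero
  pivot-pos {zero}  0<N₀₀           = 0<N₀₀
  pivot-pos {suc k} (0≤p , p<N₀₀ , _) = ℚP.≤-<-trans 0≤p p<N₀₀

  -- One step of Gaussian elimination, v being the inverse of the pivot N₀₀.
  eliminate : ∀ {k} → Matrix ℚ (suc (suc k)) → ℚ → Matrix ℚ (suc k)
  eliminate N v zero    zero    = N (suc zero) (suc zero) - coupling N * v
  eliminate N v zero    (suc c) = N (suc zero) (suc (suc c))
  eliminate N v (suc r) c       = N (suc (suc r)) (suc c)

  continuant-eliminate : ∀ {k} (N : Matrix ℚ (suc (suc k))) {v} → N zero zero * v ≡ 1ℚ →
                         continuant N ≡ N zero zero * continuant (eliminate N v)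
  continuant-eliminate {zero} N {v} N₀₀v≡1 = sym (begin
    a * (b - p * v)        ≡⟨ solve 4 (λ a b p v → a :* (b :- p :* v) := a :* b :- p :* (a :* v)) refl a b p v ⟩
    a * b - p * (a * v)    ≡⟨ cong (λ x → a * b - p * x) N₀₀v≡1 ⟩
    a * b - p * 1ℚ         ∎)
    where
    open ≡-Reasoning
    open +-*-Solver
    a b p : ℚ
    a = N zero zero
    b = N (suc zero) (suc zero)
    p = coupling N
  continuant-eliminate {suc k} N {v} N₀₀v≡1 = sym (begin
    a * ((b - p * v) * X - p₁ * Y)        ≡⟨ solve 7 (λ a b p v p₁ X Y →
                                               a :* ((b :- p :* v) :* X :- p₁ :* Y)
                                                 := a :* (b :* X :- p₁ :* Y) :- p :* (a :* v) :* X)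
                                               refl a b p v p₁ X Y ⟩
    a * (b * X - p₁ * Y) - p * (a * v) * X ≡⟨ cong (λ x → a * (b * X - p₁ * Y) - p * x * X) N₀₀v≡1 ⟩
    a * (b * X - p₁ * Y) - p * 1ℚ * X     ≡⟨ cong (λ x → a * (b * X - p₁ * Y) - x * X) (ℚP.*-identityʳ p) ⟩
    a * (b * X - p₁ * Y) - p * X          ∎)
    where
    open ≡-Reasoning
    open +-*-Solver
    a b p p₁ X Y : ℚ
    a = N zero zero
    b = N (suc zero) (suc zero)
    p = coupling N
    p₁ = coupling (↓ N)
    X = continuant (↓ (↓ N))
    Y = continuant (↓ (↓ (↓ N)))

  -- 1 + p₁ ≤ b and p v < 1 give p₁ < b - p v: the new pivot again dominates strictly.
  weaklyDominant-eliminate : ∀ {k} {N : Matrix ℚ (suc (suc k))} {v} → N zero zero * v ≡ 1ℚ → 0ℚ < v →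
                             WeaklyDominant N → WeaklyDominant (eliminate N v)
  weaklyDominant-eliminate {zero} N₀₀v≡1 0<v (_ , p<N₀₀ , (diag , _)) =
    <-sub (ℚP.<-≤-trans (ℚP.+-monoʳ-< 0ℚ (<⇒*inverse<1 N₀₀v≡1 0<v p<N₀₀)) (diag zero))
  weaklyDominant-eliminate {suc k} {N} {v} N₀₀v≡1 0<v (_ , p<N₀₀ , dom@(_ , off)) with off zero (suc zero) refl
  ... | 0≤p₁ , 1+p₁≤b =
    0≤p₁ ,
    <-sub (ℚP.<-≤-trans (ℚP.+-monoʳ-< (coupling (↓ N)) (<⇒*inverse<1 N₀₀v≡1 0<v p<N₀₀)) 1+p₁≤b′) ,
    dominant-↓ {N = ↓ N} dom
    where
    1+p₁≤b′ : coupling (↓ N) + 1ℚ ≤ N (suc zero) (suc zero)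
    1+p₁≤b′ = subst (_≤ N (suc zero) (suc zero)) (ℚP.+-comm 1ℚ (coupling (↓ N))) 1+p₁≤b

  continuant-pos : ∀ {k} {N : Matrix ℚ (suc k)} → WeaklyDominant N → 0ℚ < continuant N
  continuant-pos {zero}  0<N₀₀ = 0<N₀₀
  continuant-pos {suc k} {N} wd with positiveInverse (pivot-pos {N = N} wd)
  ... | v , N₀₀v≡1 , 0<v =
    subst (0ℚ <_) (sym (continuant-eliminate N N₀₀v≡1))
          (*-pos (pivot-pos {N = N} wd) (continuant-pos (weaklyDominant-eliminate {N = N} N₀₀v≡1 0<v wd)))

  continuant-scaled-≢0 : ∀ {n} {N : Matrix ℚ n} (s : Fin n → ℚ) → Dominant N → (∀ c → s c ≢ 0ℚ) →
                         continuant (λ r c → N r c * s c) ≢ 0ℚ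
  continuant-scaled-≢0 {zero}  s _ _ ()
  continuant-scaled-≢0 {suc n} {N} s dom s≢0 eq =
    *-≢0 (Πℚ-≢0 s s≢0) (pos⇒≢0 (continuant-pos (dominant⇒weaklyDominant {N = N} dom)))
         (trans (sym (continuant-scaleColumns N s)) eq)

  infixl 7 _·_
  _·_ : ∀ {n} → Matrix ℚ n → (Fin n → ℚ) → Fin n → ℚ
  (N · x) r = Σℚ (λ c → N r c * x c)

  ZMatrix : ∀ {n} → Matrix ℚ n → Set
  ZMatrix N = ∀ r c → toℕ r ≢ toℕ c → N r c ≤ 0ℚ

  ·-≤-diagonal : ∀ {n} {N : Matrix ℚ n} {x} → ZMatrix N → (∀ c → 0ℚ ≤ x c) → ∀ r → (N · x) r ≤ N r r * x r
  ·-≤-diagonal {N = N} {x} Z 0≤x r = Σℚ-≤-term (λ c → N r c * x c) r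
    (λ c c≢r → nonPos*nonNeg (Z r c (c≢r ∘ sym ∘ toℕ-injective)) (0≤x c))

  eliminateRhs : ∀ {k} → Matrix ℚ (suc (suc k)) → ℚ → (Fin (suc (suc k)) → ℚ) → Fin (suc k) → ℚ
  eliminateRhs N v y = (y (suc zero) - N (suc zero) zero * (y zero * v)) ∷ tail (tail y)

  pivot-solve : ∀ {a v x b y} → a * x + b ≡ y → a * v ≡ 1ℚ → x ≡ (y - b) * v
  pivot-solve {a} {v} {x} {b} {y} ax+b≡y av≡1 = begin
    x                     ≡⟨ sym (ℚP.*-identityʳ x) ⟩
    x * 1ℚ                ≡⟨ cong (x *_) (sym av≡1) ⟩
    x * (a * v)           ≡⟨ solve 5 (λ a v x b y → x :* (a :* v) := (a :* x :+ b :- b) :* v) refl a v x b y ⟩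
    (a * x + b - b) * v   ≡⟨ cong (λ z → (z - b) * v) ax+b≡y ⟩
    (y - b) * v           ∎
    where
    open ≡-Reasoning
    open +-*-Solver

  pivot-cancel : ∀ {a v} z → a * v ≡ 1ℚ → a * (z * v) ≡ z
  pivot-cancel {a} {v} z av≡1 = begin
    a * (z * v)  ≡⟨ solve 3 (λ a v z → a :* (z :* v) := z :* (a :* v)) refl a v z ⟩
    z * (a * v)  ≡⟨ cong (z *_) av≡1 ⟩
    z * 1ℚ       ≡⟨ ℚP.*-identityʳ z ⟩
    z            ∎
    where
    open ≡-Reasoning
    open +-*-Solver

  module Elimination {k} (N : Matrix ℚ (suc (suc k))) {v} (tri : Tridiagonal 0ℚ N)
                     (N₀₀v≡1 : N zero zero * v ≡ 1ℚ) where

    open ≡-Reasoning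
    open +-*-Solver

    private
      N′ : Matrix ℚ (suc k)
      N′ = eliminate N v

    row₀ : ∀ x → (N · x) zero ≡ N zero zero * x zero + N zero (suc zero) * x (suc zero)
    row₀ x = cong (λ z → N zero zero * x zero + z)
      (trans (cong (_+_ (N zero (suc zero) * x (suc zero)))
                   (Σℚ-zero (λ c → trans (cong (_* x (suc (suc c))) (tri zero (suc (suc c)) (inj₁ (s≤s (s≤s z≤n)))))
                                         (ℚP.*-zeroˡ (x (suc (suc c)))))))
             (ℚP.+-identityʳ (N zero (suc zero) * x (suc zero))))

    row₁ : ∀ x y₀ → x zero ≡ (y₀ - N zero (suc zero) * x (suc zero)) * v →
           (N · x) (suc zero) ≡ N (suc zero) zero * (y₀ * v) + (N′ · tail x) zero
    row₁ x y₀ x₀≡ = begin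
      c * x zero + (d * x₁ + R)                ≡⟨ cong (λ z → c * z + (d * x₁ + R)) x₀≡ ⟩
      c * ((y₀ - b * x₁) * v) + (d * x₁ + R)   ≡⟨ solve 7 (λ b c d x₁ y₀ v R →
                                                    c :* ((y₀ :- b :* x₁) :* v) :+ (d :* x₁ :+ R)
                                                      := c :* (y₀ :* v) :+ ((d :- b :* c :* v) :* x₁ :+ R))
                                                    refl b c d x₁ y₀ v R ⟩
      c * (y₀ * v) + ((d - b * c * v) * x₁ + R) ∎
      where
      b c d x₁ R : ℚ
      b = N zero (suc zero)
      c = N (suc zero) zero
      d = N (suc zero) (suc zero)
      x₁ = x (suc zero)
      R = Σℚ (λ j → N (suc zero) (suc (suc j)) * x (suc (suc j)))

    row₊₂ : ∀ x r → (N · x) (suc (suc r)) ≡ (N′ · tail x) (suc r)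
    row₊₂ x r = begin
      N (suc (suc r)) zero * x zero + R ≡⟨ cong (λ z → z * x zero + R) (tri (suc (suc r)) zero (inj₂ (s≤s (s≤s z≤n)))) ⟩
      0ℚ * x zero + R                   ≡⟨ cong (_+ R) (ℚP.*-zeroˡ (x zero)) ⟩
      0ℚ + R                            ≡⟨ ℚP.+-identityˡ R ⟩
      R                                 ∎
      where
      R : ℚ
      R = Σℚ (λ j → N (suc (suc r)) (suc j) * x (suc j))

    sound : ∀ {x y} → N · x ≗ y →
            x zero ≡ (y zero - N zero (suc zero) * x (suc zero)) * v × N′ · tail x ≗ eliminateRhs N v y
    sound {x} {y} Nx≗y = x₀≡ , reduced
      where
      x₀≡ : x zero ≡ (y zero - N zero (suc zero) * x (suc zero)) * v
      x₀≡ = pivot-solve {a = N zero zero} (trans (sym (row₀ x)) (Nx≗y zero)) N₀₀v≡1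
      reduced : N′ · tail x ≗ eliminateRhs N v y
      reduced zero = begin
        (N′ · tail x) zero                                   ≡⟨ solve 2 (λ a z → z := a :+ z :- a) refl (N (suc zero) zero * (y zero * v)) ((N′ · tail x) zero) ⟩
        N (suc zero) zero * (y zero * v) + (N′ · tail x) zero
          - N (suc zero) zero * (y zero * v)                 ≡⟨ cong (_- N (suc zero) zero * (y zero * v)) (sym (row₁ x (y zero) x₀≡)) ⟩
        (N · x) (suc zero) - N (suc zero) zero * (y zero * v) ≡⟨ cong (_- N (suc zero) zero * (y zero * v)) (Nx≗y (suc zero)) ⟩
        y (suc zero) - N (suc zero) zero * (y zero * v)       ∎
      reduced (suc r) = trans (sym (row₊₂ x r)) (Nx≗y (suc (suc r)))

    complete : ∀ {x′ y} → N′ · x′ ≗ eliminateRhs N v y →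
               N · ((y zero - N zero (suc zero) * x′ zero) * v ∷ x′) ≗ y
    complete {x′} {y} N′x′≗y′ zero = begin
      (N · x) zero                          ≡⟨ row₀ x ⟩
      N zero zero * x zero + b * x′ zero    ≡⟨ cong (_+ b * x′ zero) (pivot-cancel {N zero zero} (y zero - b * x′ zero) N₀₀v≡1) ⟩
      y zero - b * x′ zero + b * x′ zero    ≡⟨ solve 2 (λ y₀ z → y₀ :- z :+ z := y₀) refl (y zero) (b * x′ zero) ⟩
      y zero                                ∎
      where
      b : ℚ
      b = N zero (suc zero)
      x : Fin (suc (suc k)) → ℚ
      x = (y zero - b * x′ zero) * v ∷ x′
    complete {x′} {y} N′x′≗y′ (suc zero) = begin
      (N · x) (suc zero)                                          ≡⟨ row₁ x (y zero) refl ⟩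
      N (suc zero) zero * (y zero * v) + (N′ · x′) zero           ≡⟨ cong (_+_ (N (suc zero) zero * (y zero * v))) (N′x′≗y′ zero) ⟩
      N (suc zero) zero * (y zero * v)
        + (y (suc zero) - N (suc zero) zero * (y zero * v))      ≡⟨ solve 2 (λ a z → a :+ (z :- a) := z) refl (N (suc zero) zero * (y zero * v)) (y (suc zero)) ⟩
      y (suc zero)                                                ∎
      where
      x : Fin (suc (suc k)) → ℚ
      x = (y zero - N zero (suc zero) * x′ zero) * v ∷ x′
    complete {x′} {y} N′x′≗y′ (suc (suc r)) =
      trans (row₊₂ ((y zero - N zero (suc zero) * x′ zero) * v ∷ x′) r) (N′x′≗y′ (suc r))

  module _ {k} {N : Matrix ℚ (suc (suc k))} {v : ℚ} where

    tridiagonal-eliminate : Tridiagonal 0ℚ N → Tridiagonal 0ℚ (eliminate N v)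
    tridiagonal-eliminate tri zero    zero    (inj₁ ())
    tridiagonal-eliminate tri zero    zero    (inj₂ ())
    tridiagonal-eliminate tri zero    (suc c) (inj₁ apart) = tri (suc zero) (suc (suc c)) (inj₁ (s≤s apart))
    tridiagonal-eliminate tri zero    (suc c) (inj₂ ())
    tridiagonal-eliminate tri (suc r) c       (inj₁ apart) = tri (suc (suc r)) (suc c) (inj₁ (s≤s apart))
    tridiagonal-eliminate tri (suc r) c       (inj₂ apart) = tri (suc (suc r)) (suc c) (inj₂ (s≤s apart))

    zMatrix-eliminate : ZMatrix N → ZMatrix (eliminate N v)
    zMatrix-eliminate Z zero    zero    0≢0   = ⊥-elim (0≢0 refl)
    zMatrix-eliminate Z zero    (suc c) _     = Z (suc zero) (suc (suc c)) λ ()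
    zMatrix-eliminate Z (suc r) c       r+1≢c = Z (suc (suc r)) (suc c) (r+1≢c ∘ ℕP.suc-injective)

  solution-exists : ∀ {k} {N : Matrix ℚ (suc k)} → WeaklyDominant N → Tridiagonal 0ℚ N → ∀ y → ∃[ x ] N · x ≗ y
  solution-exists {zero} {N} wd tri y with positiveInverse (pivot-pos {N = N} wd)
  ... | v , N₀₀v≡1 , _ =
    (λ _ → y zero * v) ,
    λ { zero → trans (ℚP.+-identityʳ (N zero zero * (y zero * v))) (pivot-cancel {N zero zero} (y zero) N₀₀v≡1) }
  solution-exists {suc k} {N} wd tri y with positiveInverse (pivot-pos {N = N} wd)
  ... | v , N₀₀v≡1 , 0<v
    with solution-exists (weaklyDominant-eliminate {N = N} N₀₀v≡1 0<v wd) (tridiagonal-eliminate tri) (eliminateRhs N v y)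
  ...   | x′ , N′x′≗y′ =
    (y zero - N zero (suc zero) * x′ zero) * v ∷ x′ , Elimination.complete N tri N₀₀v≡1 {x′} N′x′≗y′

  -- Back substitution x₀ = (y₀ - N₀₁ x₁) v only adds nonnegative terms, as N₀₁, N₁₀ ≤ 0 < v.
  solution-nonNeg : ∀ {k} {N : Matrix ℚ (suc k)} → WeaklyDominant N → Tridiagonal 0ℚ N → ZMatrix N →
                    ∀ {x y} → N · x ≗ y → (∀ r → 0ℚ ≤ y r) → ∀ r → 0ℚ ≤ x r
  solution-nonNeg {zero} {N} wd tri Z {x} {y} Nx≗y 0≤y zero with positiveInverse (pivot-pos {N = N} wd)
  ... | v , N₀₀v≡1 , 0<v =
    subst (0ℚ ≤_) (sym (pivot-solve {a = N zero zero} (Nx≗y zero) N₀₀v≡1))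
          (*-nonNeg (sub-nonPos (0≤y zero) ℚP.≤-refl) (ℚP.<⇒≤ 0<v))
  solution-nonNeg {suc k} {N} wd tri Z {x} {y} Nx≗y 0≤y with positiveInverse (pivot-pos {N = N} wd)
  ... | v , N₀₀v≡1 , 0<v = nonNeg
    where
    reduced : x zero ≡ (y zero - N zero (suc zero) * x (suc zero)) * v × eliminate N v · tail x ≗ eliminateRhs N v y
    reduced = Elimination.sound N tri N₀₀v≡1 {x} Nx≗y
    0≤v : 0ℚ ≤ v
    0≤v = ℚP.<⇒≤ 0<v
    0≤y′ : ∀ r → 0ℚ ≤ eliminateRhs N v y r
    0≤y′ zero    = sub-nonPos (0≤y (suc zero)) (nonPos*nonNeg (Z (suc zero) zero λ ()) (*-nonNeg (0≤y zero) 0≤v))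
    0≤y′ (suc r) = 0≤y (suc (suc r))
    0≤x′ : ∀ r → 0ℚ ≤ x (suc r)
    0≤x′ = solution-nonNeg (weaklyDominant-eliminate {N = N} N₀₀v≡1 0<v wd) (tridiagonal-eliminate tri) (zMatrix-eliminate Z)
                           (proj₂ reduced) 0≤y′
    nonNeg : ∀ r → 0ℚ ≤ x r
    nonNeg zero    = subst (0ℚ ≤_) (sym (proj₁ reduced))
      (*-nonNeg (sub-nonPos (0≤y zero) (nonPos*nonNeg (Z zero (suc zero) λ ()) (0≤x′ zero))) 0≤v)
    nonNeg (suc r) = 0≤x′ r

  -- Determinants of tridiagonal integer matrices

  minor : ∀ {n} → Matrix ℤ (suc n) → Fin (suc n) → Matrix ℤ n
  minor M j r c = M (suc r) (punchIn j c)

  Σℤ-zero : ∀ {n} {f : Fin n → ℤ} → (∀ i → f i ≡ + 0) → Σℤ f ≡ + 0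
  Σℤ-zero {zero}  f≗0 = refl
  Σℤ-zero {suc n} f≗0 = cong₂ ℤ._+_ (f≗0 zero) (Σℤ-zero (f≗0 ∘ suc))

  -- The sign function of det is local to Defs, so the first-row Laplace summands for the columns
  -- 1, 2, … are named by unification against the unfolding of det; likewise the goal of
  -- laplaceTail-zero once the column index has been abstracted.
  mutual
    laplaceTail : ∀ {n} → Matrix ℤ (suc n) → Fin n → ℤ
    laplaceTail = _

    det-laplace : ∀ {n} (M : Matrix ℤ (suc n)) →
                  det M ≡ + 1 ℤ.* (M zero zero ℤ.* det (↓ M)) ℤ.+ Σℤ (laplaceTail M)
    det-laplace M = refl

  mutual
    SignTimesZero : ∀ {n} → Matrix ℤ (suc n) → ℕ → Set
    SignTimesZero = _

    laplaceTail-zero : ∀ {n} (M : Matrix ℤ (suc n)) i →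
                       M zero (suc i) ℤ.* det (minor M (suc i)) ≡ + 0 → laplaceTail M i ≡ + 0
    laplaceTail-zero M i term≡0 with M zero (suc i) ℤ.* det (minor M (suc i)) | term≡0 | toℕ i
    ... | .(+ 0) | refl | k = sign*0 M k

    sign*0 : ∀ {n} (M : Matrix ℤ (suc n)) k → SignTimesZero M k
    sign*0 M zero          = refl
    sign*0 M (suc zero)    = refl
    sign*0 M (suc (suc k)) = sign*0 M k

  mutual
    det-zeroColumn : ∀ {n} (M : Matrix ℤ (suc n)) → (∀ r → M r zero ≡ + 0) → det M ≡ + 0
    det-zeroColumn M col≡0 =
      trans (det-laplace M)
            (cong₂ (λ a s → + 1 ℤ.* (a ℤ.* det (↓ M)) ℤ.+ s)
                   (col≡0 zero) (Σℤ-zero (λ i → laplaceTail-zeroColumn M i (col≡0 ∘ suc))))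

    laplaceTail-zeroColumn : ∀ {n} (M : Matrix ℤ (suc n)) i → (∀ r → M (suc r) zero ≡ + 0) → laplaceTail M i ≡ + 0
    laplaceTail-zeroColumn {suc n} M i col≡0 =
      laplaceTail-zero M i (trans (cong (M zero (suc i) ℤ.*_) (det-zeroColumn (minor M (suc i)) col≡0))
                                  (ℤP.*-zeroʳ (M zero (suc i))))

  det-tridiagonal : ∀ {k} (M : Matrix ℤ (suc (suc k))) → Tridiagonal (+ 0) M →
    det M ≡ M zero zero ℤ.* det (↓ M) ℤ.- M zero (suc zero) ℤ.* (M (suc zero) zero ℤ.* det (↓ (↓ M)))
  det-tridiagonal M tri = begin
    det M                                                    ≡⟨ det-laplace M ⟩
    + 1 ℤ.* (a ℤ.* det (↓ M)) ℤ.+ (ℤ.- (+ 1) ℤ.* (b ℤ.* det (minor M (suc zero)))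
      ℤ.+ Σℤ (λ i → laplaceTail M (suc i)))                 ≡⟨ cong₂ (λ d s → + 1 ℤ.* (a ℤ.* det (↓ M)) ℤ.+ (ℤ.- (+ 1) ℤ.* (b ℤ.* d) ℤ.+ s))
                                                                     minor₀₁ (Σℤ-zero beyond-band) ⟩
    + 1 ℤ.* (a ℤ.* det (↓ M)) ℤ.+ (ℤ.- (+ 1) ℤ.* (b ℤ.* (+ 1 ℤ.* (c ℤ.* det (↓ (↓ M))) ℤ.+ + 0))
      ℤ.+ + 0)                                               ≡⟨ solve 5 (λ a d b c e →
                                                                   con (+ 1) :* (a :* d)
                                                                     :+ (con (ℤ.- (+ 1)) :* (b :* (con (+ 1) :* (c :* e) :+ con (+ 0))) :+ con (+ 0))
                                                                     := a :* d :- b :* (c :* e))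
                                                                 refl a (det (↓ M)) b c (det (↓ (↓ M))) ⟩
    a ℤ.* det (↓ M) ℤ.- b ℤ.* (c ℤ.* det (↓ (↓ M)))          ∎
    where
    open ≡-Reasoning
    open ZSolver.+-*-Solver
    a b c : ℤ
    a = M zero zero
    b = M zero (suc zero)
    c = M (suc zero) zero
    beyond-band : ∀ i → laplaceTail M (suc i) ≡ + 0
    beyond-band i = laplaceTail-zero M (suc i)
      (cong (ℤ._* det (minor M (suc (suc i)))) (tri zero (suc (suc i)) (inj₁ (s≤s (s≤s z≤n)))))
    minor₀₁ : det (minor M (suc zero)) ≡ + 1 ℤ.* (c ℤ.* det (↓ (↓ M))) ℤ.+ + 0
    minor₀₁ = cong (ℤ._+_ (+ 1 ℤ.* (c ℤ.* det (↓ (↓ M))))) (Σℤ-zero (λ i →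
      laplaceTail-zeroColumn (minor M (suc zero)) i (λ r → tri (suc (suc r)) zero (inj₂ (s≤s (s≤s z≤n))))))

  toℚ-det : ∀ {n} (M : Matrix ℤ n) → Tridiagonal (+ 0) M → toℚ (det M) ≡ continuant (λ r c → toℚ (M r c))
  toℚ-det {zero}        M tri = refl
  toℚ-det {suc zero}    M tri =
    cong toℚ (trans (ℤP.+-identityʳ (+ 1 ℤ.* (M zero zero ℤ.* + 1)))
                    (trans (ℤP.*-identityˡ (M zero zero ℤ.* + 1)) (ℤP.*-identityʳ (M zero zero))))
  toℚ-det {suc (suc k)} M tri = begin
    toℚ (det M)                                      ≡⟨ cong toℚ (det-tridiagonal M tri) ⟩
    toℚ (a ℤ.* d₁ ℤ.- b ℤ.* (c ℤ.* d₂))              ≡⟨ toℚ-+ (a ℤ.* d₁) (ℤ.- (b ℤ.* (c ℤ.* d₂))) ⟩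
    toℚ (a ℤ.* d₁) + toℚ (ℤ.- (b ℤ.* (c ℤ.* d₂)))    ≡⟨ cong₂ _+_ (toℚ-* a d₁) (trans (toℚ-neg (b ℤ.* (c ℤ.* d₂))) (cong -_ (toℚ-* b (c ℤ.* d₂)))) ⟩
    toℚ a * toℚ d₁ - toℚ b * toℚ (c ℤ.* d₂)          ≡⟨ cong (λ z → toℚ a * toℚ d₁ - toℚ b * z) (toℚ-* c d₂) ⟩
    toℚ a * toℚ d₁ - toℚ b * (toℚ c * toℚ d₂)        ≡⟨ cong (λ z → toℚ a * toℚ d₁ - z) (sym (ℚP.*-assoc (toℚ b) (toℚ c) (toℚ d₂))) ⟩
    toℚ a * toℚ d₁ - toℚ b * toℚ c * toℚ d₂          ≡⟨ cong₂ (λ X Y → toℚ a * X - toℚ b * toℚ c * Y)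
                                                              (toℚ-det (↓ M) (tridiagonal-↓ tri))
                                                              (toℚ-det (↓ (↓ M)) (tridiagonal-↓ (tridiagonal-↓ tri))) ⟩
    continuant (λ r c → toℚ (M r c))                 ∎
    where
    open ≡-Reasoning
    a b c d₁ d₂ : ℤ
    a = M zero zero
    b = M zero (suc zero)
    c = M (suc zero) zero
    d₁ = det (↓ M)
    d₂ = det (↓ (↓ M))

  det-≢0 : ∀ {k} (M : Matrix ℤ k) (N : Matrix ℚ k) (s : Fin k → ℚ) → (∀ r c → toℚ (M r c) ≡ N r c * s c) →
           Tridiagonal 0ℚ N → Dominant N → (∀ c → s c ≢ 0ℚ) → det M ≢ + 0
  det-≢0 M N s M≡Ns tri dom s≢0 det≡0 = continuant-scaled-≢0 {N = N} s dom s≢0 (begin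
    continuant (λ r c → N r c * s c)  ≡⟨ continuant-cong (λ r c → sym (M≡Ns r c)) ⟩
    continuant (λ r c → toℚ (M r c))  ≡⟨ sym (toℚ-det M tri′) ⟩
    toℚ (det M)                       ≡⟨ cong toℚ det≡0 ⟩
    0ℚ                                ∎)
    where
    open ≡-Reasoning
    tri′ : Tridiagonal (+ 0) M
    tri′ r c apart = toℚ-injective (trans (M≡Ns r c) (trans (cong (_* s c) (tri r c apart)) (ℚP.*-zeroˡ (s c))))

  -- Primitive generators

  foldℕ-lcm-∣ : ∀ {n} (f : Fin n → ℕ) j → f j ∣ foldℕ lcm 1 f
  foldℕ-lcm-∣ f zero    = m∣lcm[m,n] (f zero) _
  foldℕ-lcm-∣ f (suc j) = ∣-trans (foldℕ-lcm-∣ (f ∘ suc) j) (n∣lcm[m,n] (f zero) _)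

  foldℕ-lcm-≢0 : ∀ {n} (f : Fin n → ℕ) → (∀ j → f j ≢ 0) → foldℕ lcm 1 f ≢ 0
  foldℕ-lcm-≢0 {zero}  f f≢0 ()
  foldℕ-lcm-≢0 {suc n} f f≢0 lcm≡0 =
    [ f≢0 zero , foldℕ-lcm-≢0 (f ∘ suc) (f≢0 ∘ suc) ]′ (ℕP.m*n≡0⇒m≡0∨n≡0 (f zero) f₀L≡0)
    where
    L : ℕ
    L = foldℕ lcm 1 (f ∘ suc)
    f₀L≡0 : f zero ℕ.* L ≡ 0
    f₀L≡0 = trans (sym (gcd*lcm (f zero) L)) (trans (cong (gcd (f zero) L ℕ.*_) lcm≡0) (ℕP.*-zeroʳ (gcd (f zero) L)))

  foldℕ-gcd-∣ : ∀ {n} (f : Fin n → ℕ) j → foldℕ gcd 0 f ∣ f j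
  foldℕ-gcd-∣ f zero    = gcd[m,n]∣m (f zero) _
  foldℕ-gcd-∣ f (suc j) = ∣-trans (gcd[m,n]∣n (f zero) _) (foldℕ-gcd-∣ (f ∘ suc) j)

  foldℕ-gcd-≢0 : ∀ {n} (f : Fin n → ℕ) k → f k ≢ 0 → foldℕ gcd 0 f ≢ 0
  foldℕ-gcd-≢0 f zero    f₀≢0 gcd≡0 = f₀≢0 (gcd[m,n]≡0⇒m≡0 gcd≡0)
  foldℕ-gcd-≢0 f (suc k) fk≢0 gcd≡0 = foldℕ-gcd-≢0 (f ∘ suc) k fk≢0 (gcd[m,n]≡0⇒n≡0 (f zero) gcd≡0)

  /ℕ-exact : ∀ a d .{{_ : ℕ.NonZero d}} → d ∣ ℤ.∣ a ∣ → (a ℤ./ℕ d) ℤ.* + d ≡ a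
  /ℕ-exact (+ n)    d d∣n = trans (sym (ℤP.pos-* (n ℕ./ d) d)) (cong +_ (m/n*n≡m d∣n))
  /ℕ-exact -[1+ n ] d d∣n rewrite n∣m⇒m%n≡0 (suc n) d d∣n =
    trans (sym (ℤP.neg-distribˡ-* (+ (suc n ℕ./ d)) (+ d))) (cong ℤ.-_ (trans (sym (ℤP.pos-* (suc n ℕ./ d) d)) (cong +_ (m/n*n≡m d∣n))))

  module _ {n} (v : Fin n → ℚ) where

    -- Definitionally the local L, w and gcd of primGen, which Defs does not export.
    commonDenominator : ℕ
    commonDenominator = foldℕ lcm 1 (λ j → ℚ.denominatorℕ (v j))

    clearedVector : Fin n → ℤ
    clearedVector j = ℚ.numerator (v j) ℤ.* (+ (commonDenominator ℕ./ ℚ.denominatorℕ (v j)))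

    content : ℕ
    content = foldℕ gcd 0 (λ j → ℤ.∣ clearedVector j ∣)

    commonDenominator≢0 : commonDenominator ≢ 0
    commonDenominator≢0 = foldℕ-lcm-≢0 (λ j → ℚ.denominatorℕ (v j)) (λ j ())

    toℚ-clearedVector : ∀ j → toℚ (clearedVector j) ≡ v j * toℚ (+ commonDenominator)
    toℚ-clearedVector j = begin
      toℚ (ℚ.numerator (v j) ℤ.* + (L ℕ./ d))         ≡⟨ toℚ-* (ℚ.numerator (v j)) (+ (L ℕ./ d)) ⟩
      toℚ (ℚ.numerator (v j)) * toℚ (+ (L ℕ./ d))     ≡⟨ cong (_* toℚ (+ (L ℕ./ d))) (toℚ-numerator (v j)) ⟩
      v j * toℚ (+ d) * toℚ (+ (L ℕ./ d))             ≡⟨ ℚP.*-assoc (v j) (toℚ (+ d)) (toℚ (+ (L ℕ./ d))) ⟩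
      v j * (toℚ (+ d) * toℚ (+ (L ℕ./ d)))           ≡⟨ cong (v j *_) (sym (toℚ-* (+ d) (+ (L ℕ./ d)))) ⟩
      v j * toℚ (+ d ℤ.* + (L ℕ./ d))                 ≡⟨ cong (λ z → v j * toℚ z) (sym (ℤP.pos-* d (L ℕ./ d))) ⟩
      v j * toℚ (+ (d ℕ.* (L ℕ./ d)))                 ≡⟨ cong (λ z → v j * toℚ (+ z)) (m*[n/m]≡n (foldℕ-lcm-∣ (λ i → ℚ.denominatorℕ (v i)) j)) ⟩
      v j * toℚ (+ L)                                 ∎
      where
      open ≡-Reasoning
      L d : ℕ
      L = commonDenominator
      d = ℚ.denominatorℕ (v j)

    primGen-content : ∀ g → content ≡ suc g → ∀ j → primGen v j ≡ clearedVector j ℤ./ℕ suc g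
    primGen-content g content≡1+g j rewrite content≡1+g = refl

    toℚ-primGen : ∀ g → content ≡ suc g → ∀ j → toℚ (primGen v j) * toℚ (+ suc g) ≡ v j * toℚ (+ commonDenominator)
    toℚ-primGen g content≡1+g j = begin
      toℚ (primGen v j) * toℚ (+ G)    ≡⟨ cong (λ z → toℚ z * toℚ (+ G)) (primGen-content g content≡1+g j) ⟩
      toℚ (w ℤ./ℕ G) * toℚ (+ G)       ≡⟨ sym (toℚ-* (w ℤ./ℕ G) (+ G)) ⟩
      toℚ (w ℤ./ℕ G ℤ.* + G)           ≡⟨ cong toℚ (/ℕ-exact w G G∣w) ⟩
      toℚ w                            ≡⟨ toℚ-clearedVector j ⟩
      v j * toℚ (+ commonDenominator)  ∎
      where
      open ≡-Reasoning
      G : ℕ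
      G = suc g
      w : ℤ
      w = clearedVector j
      G∣w : G ∣ ℤ.∣ w ∣
      G∣w = subst (_∣ ℤ.∣ w ∣) content≡1+g (foldℕ-gcd-∣ (λ i → ℤ.∣ clearedVector i ∣) j)

    clearedVector-≢0 : ∀ k → v k ≢ 0ℚ → ℤ.∣ clearedVector k ∣ ≢ 0
    clearedVector-≢0 k vk≢0 ∣wk∣≡0 = *-≢0 vk≢0 (pos⇒≢0 (toℚ-pos commonDenominator commonDenominator≢0))
      (trans (sym (toℚ-clearedVector k)) (cong toℚ (ℤP.∣i∣≡0⇒i≡0 {clearedVector k} ∣wk∣≡0)))

    -- primGen v = (L / content) v
    primGen-positiveMultiple : ∀ k → v k ≢ 0ℚ → ∃[ t ] (0ℚ < t × ∀ j → toℚ (primGen v j) ≡ t * v j)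
    primGen-positiveMultiple k vk≢0 = toℚ (+ L) * u , *-pos (toℚ-pos L commonDenominator≢0) 0<u , scaled
      where
      open ≡-Reasoning
      open +-*-Solver
      L g G : ℕ
      L = commonDenominator
      g = ℕ.pred content
      G = suc g
      content≡G : content ≡ G
      content≡G = sym (ℕP.suc-pred content
        {{ℕ.≢-nonZero (foldℕ-gcd-≢0 (λ j → ℤ.∣ clearedVector j ∣) k (clearedVector-≢0 k vk≢0))}})
      G⁻¹ : ∃[ u ] (toℚ (+ G) * u ≡ 1ℚ × 0ℚ < u)
      G⁻¹ = positiveInverse (toℚ-pos G λ ())
      u : ℚ
      u = proj₁ G⁻¹
      0<u : 0ℚ < u
      0<u = proj₂ (proj₂ G⁻¹)
      scaled : ∀ j → toℚ (primGen v j) ≡ toℚ (+ L) * u * v j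
      scaled j = begin
        toℚ (primGen v j)                    ≡⟨ sym (pivot-cancel {toℚ (+ G)} (toℚ (primGen v j)) (proj₁ (proj₂ G⁻¹))) ⟩
        toℚ (+ G) * (toℚ (primGen v j) * u)  ≡⟨ solve 3 (λ g p u → g :* (p :* u) := p :* g :* u) refl (toℚ (+ G)) (toℚ (primGen v j)) u ⟩
        toℚ (primGen v j) * toℚ (+ G) * u    ≡⟨ cong (_* u) (toℚ-primGen g content≡G j) ⟩
        v j * toℚ (+ L) * u                  ≡⟨ solve 3 (λ x l u → x :* l :* u := l :* u :* x) refl (v j) (toℚ (+ L)) u ⟩
        toℚ (+ L) * u * v j                  ∎

  -- The matrix A(n,q)

  far-sym : ∀ {i j} → Far i j → Far j i
  far-sym (inj₁ h) = inj₂ h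
  far-sym (inj₂ h) = inj₁ h

  far⇒1+≢ : ∀ {i j} → Far i j → suc i ≢ j
  far⇒1+≢ (inj₁ 2+i≤j) refl = ℕP.<-irrefl refl 2+i≤j
  far⇒1+≢ {i} (inj₂ 2+j≤i) refl = ℕP.<-irrefl refl (ℕP.≤-trans (ℕP.m≤n+m (suc i) 2) 2+j≤i)

  data Band (i j : ℕ) : Set where
    diagonal : i ≡ j     → Band i j
    super    : suc i ≡ j → Band i j
    sub      : i ≡ suc j → Band i j
    far      : Far i j   → Band i j

  band : ∀ i j → Band i j
  band zero          zero          = diagonal refl
  band zero          (suc zero)    = super refl
  band zero          (suc (suc j)) = far (inj₁ (s≤s (s≤s z≤n)))
  band (suc zero)    zero          = sub refl
  band (suc (suc i)) zero          = far (inj₂ (s≤s (s≤s z≤n)))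
  band (suc i)       (suc j)       with band i j
  ... | diagonal i≡j     = diagonal (cong suc i≡j)
  ... | super 1+i≡j      = super (cong suc 1+i≡j)
  ... | sub i≡1+j        = sub (cong suc i≡1+j)
  ... | far (inj₁ 2+i≤j) = far (inj₁ (s≤s 2+i≤j))
  ... | far (inj₂ 2+j≤i) = far (inj₂ (s≤s 2+j≤i))

  module _ {n : ℕ} (q : ℚ) {i j : Fin n} where

    A-diagonal : toℕ i ≡ toℕ j → A n q i j ≡ q + 1ℚ
    A-diagonal i≡j rewrite dec-true (toℕ i ℕ.≟ toℕ j) i≡j = refl

    A-super : suc (toℕ i) ≡ toℕ j → A n q i j ≡ - 1ℚ
    A-super 1+i≡j
      rewrite dec-false (toℕ i ℕ.≟ toℕ j) (λ i≡j → ℕP.1+n≢n (trans 1+i≡j (sym i≡j)))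
            | dec-true (suc (toℕ i) ℕ.≟ toℕ j) 1+i≡j = refl

    A-sub : toℕ i ≡ suc (toℕ j) → A n q i j ≡ - q
    A-sub i≡1+j
      rewrite dec-false (toℕ i ℕ.≟ toℕ j) (λ i≡j → ℕP.1+n≢n (trans (sym i≡1+j) i≡j))
            | dec-false (suc (toℕ i) ℕ.≟ toℕ j) (λ 1+i≡j → ℕP.m+1+n≢n 1 (trans (cong suc (sym i≡1+j)) 1+i≡j))
            | dec-true (toℕ i ℕ.≟ suc (toℕ j)) i≡1+j = refl

    A-far : Far (toℕ i) (toℕ j) → A n q i j ≡ 0ℚ
    A-far apart
      rewrite dec-false (toℕ i ℕ.≟ toℕ j) (far⇒≢ apart)
            | dec-false (suc (toℕ i) ℕ.≟ toℕ j) (far⇒1+≢ apart)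
            | dec-false (toℕ i ℕ.≟ suc (toℕ j)) (far⇒1+≢ (far-sym apart) ∘ sym) = refl

  module Patch {n : ℕ} (q : ℚ) (0<q : 0ℚ < q) where

    entry : Bool → Matrix ℚ n
    entry true  = A n q
    entry false = λ r c → toℚ (e c r)

    patch : (Fin n → Bool) → (Fin n → Bool) → Matrix ℚ n
    patch R C r c = entry (R r ∧ C c) r c

    1≤q+1 : 1ℚ ≤ q + 1ℚ
    1≤q+1 = subst (_≤ q + 1ℚ) (ℚP.+-identityˡ 1ℚ) (ℚP.+-monoˡ-≤ 1ℚ (ℚP.<⇒≤ 0<q))

    entry-far : ∀ b {r c} → Far (toℕ r) (toℕ c) → entry b r c ≡ 0ℚ
    entry-far true  apart = A-far q apart
    entry-far false apart = e-off (far⇒≢ (far-sym apart))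

    entry-diagonal : ∀ b i → 1ℚ ≤ entry b i i
    entry-diagonal true  i = subst (1ℚ ≤_) (sym (A-diagonal q {i} {i} refl)) 1≤q+1
    entry-diagonal false i = ℚP.≤-reflexive (sym (e-diag i))

    entry-offDiagonal : ∀ b {r c} → toℕ r ≢ toℕ c → entry b r c ≤ 0ℚ
    entry-offDiagonal false r≢c = ℚP.≤-reflexive (e-off (r≢c ∘ sym))
    entry-offDiagonal true {r} {c} r≢c with band (toℕ r) (toℕ c)
    ... | diagonal r≡c  = ⊥-elim (r≢c r≡c)
    ... | super 1+r≡c   = subst (_≤ 0ℚ) (sym (A-super q 1+r≡c)) (ℚP.neg-antimono-≤ (ℚP.<⇒≤ 0<1))
    ... | sub r≡1+c     = subst (_≤ 0ℚ) (sym (A-sub q r≡1+c)) (ℚP.neg-antimono-≤ (ℚP.<⇒≤ 0<q))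
    ... | far apart     = ℚP.≤-reflexive (A-far q apart)

    module _ (R C : Fin n → Bool) where

      patch-tridiagonal : Tridiagonal 0ℚ (patch R C)
      patch-tridiagonal r c = entry-far (R r ∧ C c)

      patch-zMatrix : ZMatrix (patch R C)
      patch-zMatrix r c = entry-offDiagonal (R r ∧ C c)

      -- A coupling of the patch is either that of A, namely (-1)(-q) = q against the diagonal
      -- entry q + 1, or involves an off-diagonal entry of the identity and vanishes.
      patch-dominant : Dominant (patch R C)
      patch-dominant = (λ i → entry-diagonal (R i ∧ C i) i) , coupling-dominated
        where
        zero-coupling : ∀ a b {d} → a ≡ 0ℚ ⊎ b ≡ 0ℚ → 1ℚ ≤ d → DominatedBy (a * b) d
        zero-coupling a b {d} a≡0⊎b≡0 1≤d = subst (λ p → DominatedBy p d) (sym (*-≡0 a≡0⊎b≡0))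
          (ℚP.≤-refl , subst (_≤ d) (sym (ℚP.+-identityʳ 1ℚ)) 1≤d)

        coupling-dominated : ∀ i j → toℕ j ≡ suc (toℕ i) →
                             DominatedBy (patch R C i j * patch R C j i) (patch R C i i)
        coupling-dominated i j j≡1+i with R i ∧ C j in Rᵢ∧Cⱼ | R j ∧ C i in Rⱼ∧Cᵢ
        ... | false | b = zero-coupling (entry false i j) (entry b j i)
                                        (inj₁ (e-off {i = j} {i} λ j≡i → ℕP.1+n≢n (trans (sym j≡1+i) j≡i)))
                                        (entry-diagonal (R i ∧ C i) i)
        ... | true  | false = zero-coupling (entry true i j) (entry false j i)
                                        (inj₂ (e-off {i = i} {j} λ i≡j → ℕP.1+n≢n (trans (sym j≡1+i) (sym i≡j))))
                                        (entry-diagonal (R i ∧ C i) i)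
        ... | true  | true
          rewrite ∧-conicalˡ (R i) (C j) Rᵢ∧Cⱼ | ∧-conicalʳ (R j) (C i) Rⱼ∧Cᵢ
                | A-super q (sym j≡1+i) | A-sub q j≡1+i | A-diagonal q {i} {i} refl =
          subst (λ p → DominatedBy p (q + 1ℚ)) (sym (solve 1 (λ q → (:- con 1ℚ) :* (:- q) := q) refl q))
                (ℚP.<⇒≤ 0<q , ℚP.≤-reflexive (ℚP.+-comm 1ℚ q))
          where
          open +-*-Solver

  -- Intersection numbers with the curve of a wall

  isJ : Label → Bool
  isJ inJ = true
  isJ inK = false
  isJ out = false

  isK : Label → Bool
  isK inJ = false
  isK inK = true
  isK out = false

  isJ⇒inJ : ∀ {l} → isJ l ≡ true → l ≡ inJ
  isJ⇒inJ {inJ} _ = refl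

  bool-cases : ∀ x → x ≡ true ⊎ x ≡ false
  bool-cases true  = inj₁ refl
  bool-cases false = inj₂ refl


  module WallCurve {n′ : ℕ} (q : ℚ) (0<q : 0ℚ < q) (w : Wall (suc n′)) where

    open Patch {suc n′} q 0<q
    open ≡-Reasoning

    private
      n : ℕ
      n = suc n′

    negα-diagonal≢0 : ∀ k → - α n q k k ≢ 0ℚ
    negα-diagonal≢0 k eq = pos⇒≢0 (ℚP.<-≤-trans 0<1 1≤q+1)
      (ℚP.neg-injective (trans (cong -_ (sym (A-diagonal q {k} {k} refl))) eq))

    -- The factor taking -α_k to the primitive generator of its ray; opaque, since normalising
    -- it (as with-abstraction does to goals mentioning it) blows up.
    opaque
      scale : ∀ k → ∃[ t ] (0ℚ < t × ∀ r → toℚ (gen n q (inj₂ k) r) ≡ t * - A n q r k)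
      scale k = primGen-positiveMultiple (λ j → - α n q k j) k (negα-diagonal≢0 k)

    t : Fin n → ℚ
    t k = proj₁ (scale k)

    0<t : ∀ k → 0ℚ < t k
    0<t k = proj₁ (proj₂ (scale k))

    -- Up to the column scaling sσ, the generators of σ are the columns of A indexed by K and
    -- standard basis vectors otherwise.
    inK? : Fin n → Bool
    inK? c = isK (lab w c)

    Mσ : Matrix ℚ n
    Mσ = patch (λ _ → true) inK?

    sσ : Fin n → ℚ
    sσ c = if inK? c then - t c else 1ℚ

    Mσ-tridiagonal : Tridiagonal 0ℚ Mσ
    Mσ-tridiagonal = patch-tridiagonal (λ _ → true) inK?

    Mσ-dominant : Dominant Mσ
    Mσ-dominant = patch-dominant (λ _ → true) inK?

    sσ≢0 : ∀ c → sσ c ≢ 0ℚ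
    sσ≢0 c with inK? c
    ... | true  = λ -t≡0 → pos⇒≢0 (0<t c) (ℚP.neg-injective -t≡0)
    ... | false = λ ()

    column : Label → Fin n → Fin n → ℤ
    column inK c = gen n q (inj₂ c)
    column inJ c = e c
    column out c = e c

    genσ-column : ∀ c → genσ n q w c ≡ column (lab w c) c
    genσ-column c with lab w c
    ... | inJ = refl
    ... | inK = refl
    ... | out = refl

    column-scaled : ∀ l c r → toℚ (column l c r) ≡ entry (isK l) r c * (if isK l then - t c else 1ℚ)
    column-scaled inJ c r = sym (ℚP.*-identityʳ _)
    column-scaled out c r = sym (ℚP.*-identityʳ _)
    column-scaled inK c r = trans (proj₂ (proj₂ (scale c)) r)
                                  (solve 2 (λ t a → t :* (:- a) := a :* (:- t)) refl (t c) (A n q r c))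
      where
      open +-*-Solver

    matσ-scaled : ∀ r c → toℚ (matσ n q w r c) ≡ Mσ r c * sσ c
    matσ-scaled r c = trans (cong (λ g → toℚ (g r)) (genσ-column c)) (column-scaled (lab w c) c r)

    multσ≢0 : multσ n q w ≢ 0
    multσ≢0 = det-≢0 (matσ n q w) Mσ sσ matσ-scaled Mσ-tridiagonal Mσ-dominant sσ≢0 ∘ ℤP.∣i∣≡0⇒i≡0

    -- The maximal minor of τ omitting row m is the principal submatrix of σ omitting m.
    multτ≢0 : multτ n q w ≢ 0
    multτ≢0 = foldℕ-gcd-≢0 (λ r → ℤ.∣ det (λ a b → matσ n q w (punchIn r a) (punchIn (m w) b)) ∣) (m w)
      (det-≢0 (submatrix (m w) (matσ n q w)) (submatrix (m w) Mσ) (sσ ∘ punchIn (m w))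
              (λ a b → matσ-scaled (punchIn (m w) a) (punchIn (m w) b))
              (tridiagonal-submatrix (m w) Mσ-tridiagonal)
              (dominant-submatrix (m w) Mσ-tridiagonal Mσ-dominant)
              (sσ≢0 ∘ punchIn (m w))
       ∘ ℤP.∣i∣≡0⇒i≡0)

    σ τ : ℚ
    σ = toℚ (+ multσ n q w)
    τ = toℚ (+ multτ n q w)

    σ⁻¹ : ∃[ v ] (σ * v ≡ 1ℚ × 0ℚ < v)
    σ⁻¹ = positiveInverse (toℚ-pos (multσ n q w) multσ≢0)

    -- mult(τ)/mult(σ), the value forced on (D_{e_m} ⋅ C)
    D : ℚ
    D = τ * proj₁ σ⁻¹

    0<D : 0ℚ < D
    0<D = *-pos (toℚ-pos (multτ n q w) multτ≢0) (proj₂ (proj₂ σ⁻¹))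

    D-unique : ∀ {x} → x * σ ≡ τ → x ≡ D
    D-unique {x} xσ≡τ = begin
      x                        ≡⟨ sym (pivot-cancel {σ} x (proj₁ (proj₂ σ⁻¹))) ⟩
      σ * (x * proj₁ σ⁻¹)      ≡⟨ sym (ℚP.*-assoc σ x (proj₁ σ⁻¹)) ⟩
      σ * x * proj₁ σ⁻¹        ≡⟨ cong (λ z → z * proj₁ σ⁻¹) (trans (ℚP.*-comm σ x) xσ≡τ) ⟩
      D                        ∎

    D-σ : D * σ ≡ τ
    D-σ = begin
      τ * proj₁ σ⁻¹ * σ        ≡⟨ ℚP.*-assoc τ (proj₁ σ⁻¹) σ ⟩
      τ * (proj₁ σ⁻¹ * σ)      ≡⟨ cong (τ *_) (trans (ℚP.*-comm (proj₁ σ⁻¹) σ) (proj₁ (proj₂ σ⁻¹))) ⟩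
      τ * 1ℚ                   ≡⟨ ℚP.*-identityʳ τ ⟩
      τ                        ∎

    outsideJ : Fin n → Bool
    outsideJ i = not (isJ (lab w i))

    S : Matrix ℚ n
    S = patch outsideJ outsideJ

    S-tridiagonal : Tridiagonal 0ℚ S
    S-tridiagonal = patch-tridiagonal outsideJ outsideJ

    S-dominant : Dominant S
    S-dominant = patch-dominant outsideJ outsideJ

    S-zMatrix : ZMatrix S
    S-zMatrix = patch-zMatrix outsideJ outsideJ

    target : Label → ℚ
    target inJ = 0ℚ
    target inK = 0ℚ
    target out = D

    b : Fin n → ℚ
    b r = target (lab w r)

    0≤b : ∀ r → 0ℚ ≤ b r
    0≤b r with lab w r
    ... | inJ = ℚP.≤-refl
    ... | inK = ℚP.≤-refl
    ... | out = ℚP.<⇒≤ 0<D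

    S-row-J : ∀ x r → isJ (lab w r) ≡ true → (S · x) r ≡ x r
    S-row-J x r r∈J rewrite r∈J = trans (Σℚ-cong (λ c → ℚP.*-comm (toℚ (e c r)) (x c))) (Σℚ-e x r)

    S-row-outsideJ : ∀ x r → isJ (lab w r) ≡ false → (∀ k → isJ (lab w k) ≡ true → x k ≡ 0ℚ) →
                     (S · x) r ≡ (A n q · x) r
    S-row-outsideJ x r r∉J x∣J≡0 = Σℚ-cong term
      where
      term : ∀ c → S r c * x c ≡ A n q r c * x c
      term c with bool-cases (isJ (lab w c))
      ... | inj₁ c∈J = trans (cong (S r c *_) (x∣J≡0 c c∈J))
                             (trans (ℚP.*-zeroʳ (S r c)) (sym (trans (cong (A n q r c *_) (x∣J≡0 c c∈J)) (ℚP.*-zeroʳ (A n q r c)))))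
      ... | inj₂ c∉J = cong (_* x c) (cong₂ (λ i j → entry (not i ∧ not j) r c) r∉J c∉J)

    coords : (Ray n → ℚ) → Fin n → ℚ
    coords d k = d (inj₂ k) * t k

    wallSum : (Ray n → ℚ) → Fin n → ℚ
    wallSum d r = Σℚ (λ i → d (inj₁ i) * toℚ (gen n q (inj₁ i) r)) + Σℚ (λ k → d (inj₂ k) * toℚ (gen n q (inj₂ k) r))

    wall-relation : ∀ d r → wallSum d r ≡ d (inj₁ r) - (A n q · coords d) r
    wall-relation d r = cong₂ _+_ (Σℚ-e (λ i → d (inj₁ i)) r) (trans (Σℚ-cong term) (Σℚ-neg (λ k → A n q r k * coords d k)))
      where
      open +-*-Solver
      term : ∀ k → d (inj₂ k) * toℚ (gen n q (inj₂ k) r) ≡ - (A n q r k * coords d k)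
      term k = trans (cong (d (inj₂ k) *_) (proj₂ (proj₂ (scale k)) r))
                     (solve 3 (λ x t a → x :* (t :* (:- a)) := :- (a :* (x :* t))) refl (d (inj₂ k)) (t k) (A n q r k))

    t⁻¹ : ∀ k → ∃[ u ] (t k * u ≡ 1ℚ × 0ℚ < u)
    t⁻¹ k = positiveInverse (0<t k)

    fromCoords : (Fin n → ℚ) → Ray n → ℚ
    fromCoords x (inj₁ i) = (A n q · x) i
    fromCoords x (inj₂ k) = x k * proj₁ (t⁻¹ k)

    coords-fromCoords : ∀ x k → coords (fromCoords x) k ≡ x k
    coords-fromCoords x k = begin
      x k * u * t k    ≡⟨ ℚP.*-assoc (x k) u (t k) ⟩
      x k * (u * t k)  ≡⟨ cong (x k *_) (trans (ℚP.*-comm u (t k)) (proj₁ (proj₂ (t⁻¹ k)))) ⟩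
      x k * 1ℚ         ≡⟨ ℚP.*-identityʳ (x k) ⟩
      x k              ∎
      where u = proj₁ (t⁻¹ k)

    fromCoords-coords : ∀ d k → fromCoords (coords d) (inj₂ k) ≡ d (inj₂ k)
    fromCoords-coords d k = begin
      d (inj₂ k) * t k * u    ≡⟨ ℚP.*-assoc (d (inj₂ k)) (t k) u ⟩
      d (inj₂ k) * (t k * u)  ≡⟨ cong (d (inj₂ k) *_) (proj₁ (proj₂ (t⁻¹ k))) ⟩
      d (inj₂ k) * 1ℚ         ≡⟨ ℚP.*-identityʳ (d (inj₂ k)) ⟩
      d (inj₂ k)              ∎
      where u = proj₁ (t⁻¹ k)

    module _ {d : Ray n → ℚ} (isD : IsIntersectionNumbers n q w d) where

      private
        vanishes : (ρ : Ray n) → (InSigmaUnion w ρ → ⊥) → d ρ ≡ 0ℚ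
        vanishes = proj₁ isD
        normalised : d (inj₁ (m w)) * σ ≡ τ
        normalised = proj₁ (proj₂ isD)
        relation : ∀ r → wallSum d r ≡ 0ℚ
        relation = proj₂ (proj₂ isD)

      coords-J : ∀ k → isJ (lab w k) ≡ true → coords d k ≡ 0ℚ
      coords-J k k∈J = trans (cong (_* t k) (vanishes (inj₂ k) λ ∉σ∪σ′ → ∉σ∪σ′ (isJ⇒inJ k∈J))) (ℚP.*-zeroˡ (t k))


      A-coords : ∀ r → (A n q · coords d) r ≡ d (inj₁ r)
      A-coords r = sym (begin
        d (inj₁ r)                                             ≡⟨ solve 2 (λ a z → a := a :- z :+ z) refl (d (inj₁ r)) ((A n q · coords d) r) ⟩
        d (inj₁ r) - (A n q · coords d) r + (A n q · coords d) r ≡⟨ cong (_+ (A n q · coords d) r) (trans (sym (wall-relation d r)) (relation r)) ⟩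
        0ℚ + (A n q · coords d) r                              ≡⟨ ℚP.+-identityˡ ((A n q · coords d) r) ⟩
        (A n q · coords d) r                                   ∎)
        where
        open +-*-Solver

      target-outsideJ : ∀ r → isJ (lab w r) ≡ false → d (inj₁ r) ≡ b r
      target-outsideJ r = by-label (lab w r) refl
        where
        by-label : ∀ l → lab w r ≡ l → isJ l ≡ false → d (inj₁ r) ≡ target l
        by-label inJ _   ()
        by-label inK r∈K _ = vanishes (inj₁ r) λ ∉σ∪σ′ → ∉σ∪σ′ r∈K
        by-label out r∉J∪K _ = trans (cong (λ i → d (inj₁ i)) (out-uniq w r r∉J∪K)) (D-unique normalised)

      intersectionNumbers-solve : S · coords d ≗ b
      intersectionNumbers-solve r = [ row-J , row-outsideJ ]′ (bool-cases (isJ (lab w r)))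
        where
        row-J : isJ (lab w r) ≡ true → (S · coords d) r ≡ b r
        row-J r∈J = begin
          (S · coords d) r   ≡⟨ S-row-J (coords d) r r∈J ⟩
          coords d r         ≡⟨ coords-J r r∈J ⟩
          0ℚ                 ≡⟨ cong target (sym (isJ⇒inJ r∈J)) ⟩
          b r                ∎
        row-outsideJ : isJ (lab w r) ≡ false → (S · coords d) r ≡ b r
        row-outsideJ r∉J = begin
          (S · coords d) r       ≡⟨ S-row-outsideJ (coords d) r r∉J coords-J ⟩
          (A n q · coords d) r   ≡⟨ A-coords r ⟩
          d (inj₁ r)             ≡⟨ target-outsideJ r r∉J ⟩
          b r                    ∎

      coords-nonNeg : ∀ k → 0ℚ ≤ coords d k
      coords-nonNeg = solution-nonNeg (dominant⇒weaklyDominant {N = S} S-dominant) S-tridiagonal S-zMatrix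
                                      intersectionNumbers-solve 0≤b

      intersectionNumbers-nonNeg : ∀ k → 0ℚ ≤ d (inj₂ k)
      intersectionNumbers-nonNeg k =
        subst (0ℚ ≤_) (fromCoords-coords d k) (*-nonNeg (coords-nonNeg k) (ℚP.<⇒≤ (proj₂ (proj₂ (t⁻¹ k)))))

      -- Row m of S x = b reads S_mm x_m + (nonpositive terms) = D > 0.
      intersectionNumber-pos : 0ℚ < d (inj₂ (m w))
      intersectionNumber-pos = subst (0ℚ <_) (fromCoords-coords d (m w)) (*-pos 0<xₘ (proj₂ (proj₂ (t⁻¹ (m w)))))
        where
        D≤Sₘₘxₘ : D ≤ S (m w) (m w) * coords d (m w)
        D≤Sₘₘxₘ = subst (_≤ S (m w) (m w) * coords d (m w)) (trans (intersectionNumbers-solve (m w)) (cong target (lab-m w)))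
                        (·-≤-diagonal S-zMatrix coords-nonNeg (m w))
        0≤Sₘₘ : 0ℚ ≤ S (m w) (m w)
        0≤Sₘₘ = ℚP.≤-trans (ℚP.<⇒≤ 0<1) (proj₁ S-dominant (m w))
        0<xₘ : 0ℚ < coords d (m w)
        0<xₘ = ℚP.*-cancelˡ-<-nonNeg (S (m w) (m w)) {{ℚ.nonNegative 0≤Sₘₘ}}
                 (subst (_< S (m w) (m w) * coords d (m w)) (sym (ℚP.*-zeroʳ (S (m w) (m w)))) (ℚP.<-≤-trans 0<D D≤Sₘₘxₘ))

    module _ {x : Fin n → ℚ} (Sx≗b : S · x ≗ b) where

      x-J : ∀ k → isJ (lab w k) ≡ true → x k ≡ 0ℚ
      x-J k k∈J = trans (sym (S-row-J x k k∈J)) (trans (Sx≗b k) (cong target (isJ⇒inJ k∈J)))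

      A-x : ∀ r → isJ (lab w r) ≡ false → (A n q · x) r ≡ b r
      A-x r r∉J = trans (sym (S-row-outsideJ x r r∉J x-J)) (Sx≗b r)

      fromCoords-vanishes : (ρ : Ray n) → (InSigmaUnion w ρ → ⊥) → fromCoords x ρ ≡ 0ℚ
      fromCoords-vanishes (inj₁ i) ∉σ∪σ′ = by-label (lab w i) refl ∉σ∪σ′
        where
        by-label : ∀ l → lab w i ≡ l → ((l ≡ inK → ⊥) → ⊥) → (A n q · x) i ≡ 0ℚ
        by-label inJ _   ∉σ∪σ′ = ⊥-elim (∉σ∪σ′ λ ())
        by-label out _   ∉σ∪σ′ = ⊥-elim (∉σ∪σ′ λ ())
        by-label inK i∈K _     = trans (A-x i (cong isJ i∈K)) (cong target i∈K)
      fromCoords-vanishes (inj₂ k) ∉σ∪σ′ = by-label (lab w k) refl ∉σ∪σ′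
        where
        by-label : ∀ l → lab w k ≡ l → ((l ≡ inJ → ⊥) → ⊥) → x k * proj₁ (t⁻¹ k) ≡ 0ℚ
        by-label inK _   ∉σ∪σ′ = ⊥-elim (∉σ∪σ′ λ ())
        by-label out _   ∉σ∪σ′ = ⊥-elim (∉σ∪σ′ λ ())
        by-label inJ k∈J _     = trans (cong (_* proj₁ (t⁻¹ k)) (x-J k (cong isJ k∈J))) (ℚP.*-zeroˡ (proj₁ (t⁻¹ k)))

      solution-intersectionNumbers : IsIntersectionNumbers n q w (fromCoords x)
      solution-intersectionNumbers = fromCoords-vanishes , normalised , relation
        where
        normalised : fromCoords x (inj₁ (m w)) * σ ≡ τ
        normalised = trans (cong (_* σ) (trans (A-x (m w) (cong isJ (lab-m w))) (cong target (lab-m w)))) D-σ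
        relation : ∀ r → wallSum (fromCoords x) r ≡ 0ℚ
        relation r = begin
          wallSum (fromCoords x) r                         ≡⟨ wall-relation (fromCoords x) r ⟩
          (A n q · x) r - (A n q · coords (fromCoords x)) r ≡⟨ cong (λ y → (A n q · x) r - y) (Σℚ-cong (λ k → cong (A n q r k *_) (coords-fromCoords x k))) ⟩
          (A n q · x) r - (A n q · x) r                     ≡⟨ ℚP.+-inverseʳ ((A n q · x) r) ⟩
          0ℚ                                               ∎

    intersectionNumbers-exist : ∃[ d ] IsIntersectionNumbers n q w d
    intersectionNumbers-exist =
      let x , Sx≗b = solution-exists (dominant⇒weaklyDominant {N = S} S-dominant) S-tridiagonal b
      in  fromCoords x , solution-intersectionNumbers Sx≗b

open import Data.Nat using (ℕ; zero; suc; _≤_)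
open import Data.Rational using (ℚ; 0ℚ; _<_)
open import Data.Fin using (Fin)
open import Data.Sum using (inj₂)
open import Data.Product using (_×_; ∃; ∃-syntax; _,_)

proposition3p5 : (n : ℕ) → 1 ≤ n → (q : ℚ) → 0ℚ < q → (C : Wall n) →
    (∃[ d ] IsIntersectionNumbers n q C d)
    × ((d : Ray n → ℚ) → IsIntersectionNumbers n q C d →
        ((i : Fin n) → 0ℚ Data.Rational.≤ d (inj₂ i))
        × (∃[ ℓ ] 0ℚ < d (inj₂ ℓ)))
proposition3p5 zero    ()
proposition3p5 (suc n) _ q 0<q C =
  intersectionNumbers-exist , λ d isD → intersectionNumbers-nonNeg isD , (m C , intersectionNumber-pos isD)
  where
  open WallCurve q 0<q C
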